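{- Let $n\in\{3,4\}$ and let $(d_1,\dots,d_n)$ be a sequence of positive integers satisfying $d_1\geq\cdots\geq d_n\geq 4$, $\sum_{i=1}^n d_i$ even, and $d_1\leq\sum_{i=2}^n(d_i-1)$. Then there exists a triangular multigraph $G$ on vertices $v_1,\dots,v_n$ with $\deg(v_i)=d_i$ for all $i$.
   Context: A multigraph is a finite graph in which multiple edges between the same pair of vertices are allowed; the degree of a vertex is the number of incident edges counted with multiplicity. A triangle in a multigraph consists of three distinct vertices which are pairwise adjacent. A multigraph is triangular if every edge is contained in a triangle. -}

module Defs where

open import Data.Nat using (ℕ; zero; suc; _+_; _<_)
open import Data.Fin using (Fin; zero; suc)
open import Data.Product using (Σ; _×_)
open import Relation.Binary.PropositionalEquality using (_≡_; _≢_)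

∑ : ∀ {n} → (Fin n → ℕ) → ℕ
∑ {zero}  f = 0
∑ {suc n} f = f zero + ∑ (λ i → f (suc i))

-- A (loopless) multigraph on vertex set Fin n, given by its edge
-- multiplicities: mult i j = number of edges between i and j.
record Multigraph (n : ℕ) : Set where
  field
    mult     : Fin n → Fin n → ℕ
    symm     : ∀ i j → mult i j ≡ mult j i
    loopless : ∀ i → mult i i ≡ 0

open Multigraph public

Adj : ∀ {n} → Multigraph n → Fin n → Fin n → Set
Adj G i j = 0 < mult G i j

deg : ∀ {n} → Multigraph n → Fin n → ℕ
deg G i = ∑ (λ j → mult G i j)

Triangular : ∀ {n} → Multigraph n → Set
Triangular {n} G = ∀ i j → Adj G i j →
  Σ (Fin n) λ k → (i ≢ j × i ≢ k × j ≢ k) × (Adj G i k × Adj G j k)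

-- Let w be the number of edges avoiding vertex 0.  In any realisation
-- d 1 + … + d (n-1) = d 0 + 2w, so parity and the bound d 0 ≤ Σ (d i - 1)
-- produce a w with n - 1 ≤ 2w ≤ d 2 + … + d (n-1).  For n = 3 the triangle with
-- multiplicities d 1 - w, d 2 - w, w realises d.  For n = 4 take K₄ with
-- multiplicities 01 : d 1 + 1 - w, 02 : d 2 + 1 - w, 03 : d 3 - 2, 12 : w - 2 and
-- 13 = 23 = 1; the edge 12 may vanish, but every other edge is present, which
-- already makes the multigraph triangular.
module Submission where

open import Defs
open import Data.Nat using (ℕ; zero; suc; _+_; _*_; _≤_; _<_; _∸_; z≤n; s≤s; z<s)
open import Data.Nat.Properties hiding (_≟_)
open import Data.Nat.Divisibility using (_∣_; divides; ∣m+n∣m⇒∣n)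
open import Data.Nat.Tactic.RingSolver using (solve; solve-∀)
open import Data.Fin using (Fin; zero; suc; _≟_)
import Data.Fin as F
open import Data.Fin.Patterns using (0F; 1F; 2F; 3F)
open import Data.List using ([]; _∷_)
open import Data.Product using (Σ; ∃; _×_; _,_)
open import Data.Sum using (_⊎_; inj₁; inj₂)
open import Function using (_∘_)
open import Relation.Nullary.Decidable using (False; toWitnessFalse)
open import Relation.Binary.PropositionalEquality
  using (_≡_; _≢_; refl; sym; trans; cong; cong₂; subst; subst₂; module ≡-Reasoning)

open ≡-Reasoning

m+m≡m*2 : ∀ m → m + m ≡ m * 2
m+m≡m*2 = solve-∀

+-identityʳ² : ∀ m → (m + 0) + 0 ≡ m
+-identityʳ² m = trans (+-identityʳ (m + 0)) (+-identityʳ m)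

m+m≤n+n⇒m≤n : ∀ {m n} → m + m ≤ n + n → m ≤ n
m+m≤n+n⇒m≤n {m} {n} h = *-cancelʳ-≤ m n 2 (subst₂ _≤_ (m+m≡m*2 m) (m+m≡m*2 n) h)

m+m≤n⇒m<n : ∀ {m n} → 0 < m → m + m ≤ n → m < n
m+m≤n⇒m<n {m} 0<m = ≤-trans (m<m+n m 0<m)

2∣m+n⇒m≤n⇒∃[w]m+[w+w]≡n : ∀ {m n} → 2 ∣ m + n → m ≤ n → ∃ λ w → m + (w + w) ≡ n
2∣m+n⇒m≤n⇒∃[w]m+[w+w]≡n {m} even m≤n with m≤n⇒∃[o]m+o≡n m≤n
... | s , refl with ∣m+n∣m⇒∣n (subst (2 ∣_) (sym (+-assoc m m s)) even) (divides m (m+m≡m*2 m))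
... | divides w refl = w , cong (m +_) (m+m≡m*2 w)

∑[d∸1]+n≡∑d : ∀ {n} (d : Fin n → ℕ) → (∀ i → 1 ≤ d i) → ∑ (λ i → d i ∸ 1) + n ≡ ∑ d
∑[d∸1]+n≡∑d {zero}  d _   = refl
∑[d∸1]+n≡∑d {suc n} d pos = begin
  (d 0F ∸ 1 + ∑ (λ i → d (suc i) ∸ 1)) + suc n    ≡⟨ shuffle (d 0F ∸ 1) _ n ⟩
  (d 0F ∸ 1 + 1) + (∑ (λ i → d (suc i) ∸ 1) + n)  ≡⟨ cong₂ _+_ (m∸n+n≡m (pos 0F))
                                                        (∑[d∸1]+n≡∑d (d ∘ F.suc) (pos ∘ F.suc)) ⟩
  d 0F + ∑ (d ∘ F.suc)                             ∎
  where
  shuffle : ∀ a s n → (a + s) + suc n ≡ (a + 1) + (s + n)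
  shuffle = solve-∀

m≤∑[d∸1]⇒m+n≤∑d : ∀ {n m} (d : Fin n → ℕ) → (∀ i → 1 ≤ d i) →
  m ≤ ∑ (λ i → d i ∸ 1) → m + n ≤ ∑ d
m≤∑[d∸1]⇒m+n≤∑d {n} d pos m≤ = ≤-trans (+-monoˡ-≤ n m≤) (≤-reflexive (∑[d∸1]+n≡∑d d pos))

edgesAwayFromFirst : ∀ {k} (d : Fin (2 + k) → ℕ) → d 1F ≤ d 0F → 2 ∣ ∑ d →
  d 0F + (1 + k) ≤ ∑ (d ∘ F.suc) →
  ∃ λ w → d 0F + (w + w) ≡ ∑ (d ∘ F.suc) × 1 + k ≤ w + w × w + w ≤ ∑ (d ∘ F.suc ∘ F.suc)
edgesAwayFromFirst {k} d d₁≤d₀ even room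
  with w , gap ← 2∣m+n⇒m≤n⇒∃[w]m+[w+w]≡n even (≤-trans (m≤m+n (d 0F) (1 + k)) room)
  = w , gap , enough , notTooMany
  where
  enough : 1 + k ≤ w + w
  enough = +-cancelˡ-≤ (d 0F) _ _ (subst (d 0F + (1 + k) ≤_) (sym gap) room)

  notTooMany : w + w ≤ ∑ (d ∘ F.suc ∘ F.suc)
  notTooMany = +-cancelˡ-≤ (d 1F) _ _ (subst (d 1F + (w + w) ≤_) gap (+-monoˡ-≤ (w + w) d₁≤d₀))

underlying : ∀ {n} (arcs : Fin n → Fin n → ℕ) → (∀ i → arcs i i ≡ 0) → Multigraph n
underlying arcs noLoops = record
  { mult     = λ i j → arcs i j + arcs j i
  ; symm     = λ i j → +-comm (arcs i j) (arcs j i)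
  ; loopless = λ i → cong₂ _+_ (noLoops i) (noLoops i)
  }

-- For concrete distinct vertices the three implicit arguments normalise to ⊤
-- and are filled in by Agda.
commonNeighbour : ∀ {n} (G : Multigraph n) {i j : Fin n} (k : Fin n) →
  {i≢j : False (i ≟ j)} {i≢k : False (i ≟ k)} {j≢k : False (j ≟ k)} →
  Adj G i k → Adj G j k →
  Σ (Fin n) λ k → (i ≢ j × i ≢ k × j ≢ k) × (Adj G i k × Adj G j k)
commonNeighbour G k {i≢j} {i≢k} {j≢k} ik jk =
  k , (toWitnessFalse i≢j , toWitnessFalse i≢k , toWitnessFalse j≢k) , (ik , jk)

k₃Arcs : (m₀₁ m₀₂ m₁₂ : ℕ) → Fin 3 → Fin 3 → ℕ
k₃Arcs m₀₁ m₀₂ m₁₂ 0F 1F = m₀₁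
k₃Arcs m₀₁ m₀₂ m₁₂ 0F 2F = m₀₂
k₃Arcs m₀₁ m₀₂ m₁₂ 1F 2F = m₁₂
k₃Arcs m₀₁ m₀₂ m₁₂ _  _  = 0

k₃ : (m₀₁ m₀₂ m₁₂ : ℕ) → Multigraph 3
k₃ m₀₁ m₀₂ m₁₂ = underlying (k₃Arcs m₀₁ m₀₂ m₁₂) λ { 0F → refl ; 1F → refl ; 2F → refl }

module _ (m₀₁ m₀₂ m₁₂ : ℕ) where

  private
    G : Multigraph 3
    G = k₃ (suc m₀₁) (suc m₀₂) (suc m₁₂)

  k₃-triangular : Triangular G
  k₃-triangular 0F 1F _ = commonNeighbour G 2F z<s z<s
  k₃-triangular 0F 2F _ = commonNeighbour G 1F z<s z<s
  k₃-triangular 1F 0F _ = commonNeighbour G 2F z<s z<s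
  k₃-triangular 1F 2F _ = commonNeighbour G 0F z<s z<s
  k₃-triangular 2F 0F _ = commonNeighbour G 1F z<s z<s
  k₃-triangular 2F 1F _ = commonNeighbour G 0F z<s z<s
  k₃-triangular 0F 0F ()
  k₃-triangular 1F 1F ()
  k₃-triangular 2F 2F ()

k₃-degrees : (m₀₁ m₀₂ m₁₂ : ℕ) → Fin 3 → ℕ
k₃-degrees m₀₁ m₀₂ m₁₂ 0F = m₀₁ + m₀₂
k₃-degrees m₀₁ m₀₂ m₁₂ 1F = m₀₁ + m₁₂
k₃-degrees m₀₁ m₀₂ m₁₂ 2F = m₀₂ + m₁₂

deg-k₃ : ∀ m₀₁ m₀₂ m₁₂ i → deg (k₃ m₀₁ m₀₂ m₁₂) i ≡ k₃-degrees m₀₁ m₀₂ m₁₂ i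
deg-k₃ m₀₁ m₀₂ m₁₂ 0F = cong₂ _+_ (+-identityʳ m₀₁) (+-identityʳ² m₀₂)
deg-k₃ m₀₁ m₀₂ m₁₂ 1F = cong (m₀₁ +_) (+-identityʳ² m₁₂)
deg-k₃ m₀₁ m₀₂ m₁₂ 2F = cong (m₀₂ +_) (+-identityʳ m₁₂)

k₄Arcs : (m₀₁ m₀₂ m₀₃ m₁₂ m₁₃ m₂₃ : ℕ) → Fin 4 → Fin 4 → ℕ
k₄Arcs m₀₁ m₀₂ m₀₃ m₁₂ m₁₃ m₂₃ 0F 1F = m₀₁
k₄Arcs m₀₁ m₀₂ m₀₃ m₁₂ m₁₃ m₂₃ 0F 2F = m₀₂
k₄Arcs m₀₁ m₀₂ m₀₃ m₁₂ m₁₃ m₂₃ 0F 3F = m₀₃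
k₄Arcs m₀₁ m₀₂ m₀₃ m₁₂ m₁₃ m₂₃ 1F 2F = m₁₂
k₄Arcs m₀₁ m₀₂ m₀₃ m₁₂ m₁₃ m₂₃ 1F 3F = m₁₃
k₄Arcs m₀₁ m₀₂ m₀₃ m₁₂ m₁₃ m₂₃ 2F 3F = m₂₃
k₄Arcs m₀₁ m₀₂ m₀₃ m₁₂ m₁₃ m₂₃ _  _  = 0

k₄ : (m₀₁ m₀₂ m₀₃ m₁₂ m₁₃ m₂₃ : ℕ) → Multigraph 4
k₄ m₀₁ m₀₂ m₀₃ m₁₂ m₁₃ m₂₃ = underlying (k₄Arcs m₀₁ m₀₂ m₀₃ m₁₂ m₁₃ m₂₃)
  λ { 0F → refl ; 1F → refl ; 2F → refl ; 3F → refl }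

module _ (m₀₁ m₀₂ m₀₃ m₁₂ m₁₃ m₂₃ : ℕ) where

  private
    G : Multigraph 4
    G = k₄ (suc m₀₁) (suc m₀₂) (suc m₀₃) m₁₂ (suc m₁₃) (suc m₂₃)

  k₄-triangular : Triangular G
  k₄-triangular 0F 1F _ = commonNeighbour G 3F z<s z<s
  k₄-triangular 0F 2F _ = commonNeighbour G 3F z<s z<s
  k₄-triangular 0F 3F _ = commonNeighbour G 1F z<s z<s
  k₄-triangular 1F 0F _ = commonNeighbour G 3F z<s z<s
  k₄-triangular 1F 2F _ = commonNeighbour G 3F z<s z<s
  k₄-triangular 1F 3F _ = commonNeighbour G 0F z<s z<s
  k₄-triangular 2F 0F _ = commonNeighbour G 3F z<s z<s
  k₄-triangular 2F 1F _ = commonNeighbour G 3F z<s z<s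
  k₄-triangular 2F 3F _ = commonNeighbour G 0F z<s z<s
  k₄-triangular 3F 0F _ = commonNeighbour G 1F z<s z<s
  k₄-triangular 3F 1F _ = commonNeighbour G 0F z<s z<s
  k₄-triangular 3F 2F _ = commonNeighbour G 0F z<s z<s
  k₄-triangular 0F 0F ()
  k₄-triangular 1F 1F ()
  k₄-triangular 2F 2F ()
  k₄-triangular 3F 3F ()

k₄-degrees : (m₀₁ m₀₂ m₀₃ m₁₂ m₁₃ m₂₃ : ℕ) → Fin 4 → ℕ
k₄-degrees m₀₁ m₀₂ m₀₃ m₁₂ m₁₃ m₂₃ 0F = m₀₁ + (m₀₂ + m₀₃)
k₄-degrees m₀₁ m₀₂ m₀₃ m₁₂ m₁₃ m₂₃ 1F = m₀₁ + (m₁₂ + m₁₃)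
k₄-degrees m₀₁ m₀₂ m₀₃ m₁₂ m₁₃ m₂₃ 2F = m₀₂ + (m₁₂ + m₂₃)
k₄-degrees m₀₁ m₀₂ m₀₃ m₁₂ m₁₃ m₂₃ 3F = m₀₃ + (m₁₃ + m₂₃)

deg-k₄ : ∀ m₀₁ m₀₂ m₀₃ m₁₂ m₁₃ m₂₃ i →
  deg (k₄ m₀₁ m₀₂ m₀₃ m₁₂ m₁₃ m₂₃) i ≡ k₄-degrees m₀₁ m₀₂ m₀₃ m₁₂ m₁₃ m₂₃ i
deg-k₄ m₀₁ m₀₂ m₀₃ m₁₂ m₁₃ m₂₃ 0F =
  cong₂ _+_ (+-identityʳ m₀₁) (cong₂ _+_ (+-identityʳ m₀₂) (+-identityʳ² m₀₃))
deg-k₄ m₀₁ m₀₂ m₀₃ m₁₂ m₁₃ m₂₃ 1F = cong (m₀₁ +_) (cong₂ _+_ (+-identityʳ m₁₂) (+-identityʳ² m₁₃))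
deg-k₄ m₀₁ m₀₂ m₀₃ m₁₂ m₁₃ m₂₃ 2F = cong (λ m → m₀₂ + (m₁₂ + m)) (+-identityʳ² m₂₃)
deg-k₄ m₀₁ m₀₂ m₀₃ m₁₂ m₁₃ m₂₃ 3F = cong (λ m → m₀₃ + (m₁₃ + m)) (+-identityʳ m₂₃)

k₃-realisation : (d : Fin 3 → ℕ) → d 2F ≤ d 1F → ∀ w → 2 ≤ w + w →
  d 0F + (w + w) ≡ ∑ (d ∘ F.suc) → w + w ≤ ∑ (d ∘ F.suc ∘ F.suc) →
  Σ (Multigraph 3) λ G → Triangular G × (∀ i → deg G i ≡ d i)
k₃-realisation d d₂≤d₁ w@(suc z) _ gap few
  with w<d₂ ← m+m≤n⇒m<n z<s (subst (w + w ≤_) (+-identityʳ (d 2F)) few)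
  with x , ex ← m≤n⇒∃[o]m+o≡n (≤-trans w<d₂ d₂≤d₁)
     | y , ey ← m≤n⇒∃[o]m+o≡n w<d₂
  = k₃ (suc x) (suc y) w , k₃-triangular x y z ,
    λ i → trans (deg-k₃ (suc x) (suc y) w i) (fits i)
  where
  fits : ∀ i → k₃-degrees (suc x) (suc y) w i ≡ d i
  fits 0F = +-cancelʳ-≡ (w + w) _ _ (begin
    (suc x + suc y) + (w + w)        ≡⟨ solve (x ∷ y ∷ z ∷ []) ⟩
    (suc w + x) + ((suc w + y) + 0)  ≡⟨ cong₂ _+_ ex (cong (_+ 0) ey) ⟩
    ∑ (d ∘ F.suc)                    ≡⟨ sym gap ⟩
    d 0F + (w + w)                   ∎)
  fits 1F = begin suc x + w ≡⟨ solve (x ∷ z ∷ []) ⟩ suc w + x ≡⟨ ex ⟩ d 1F ∎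
  fits 2F = begin suc y + w ≡⟨ solve (y ∷ z ∷ []) ⟩ suc w + y ≡⟨ ey ⟩ d 2F ∎

k₄-realisation : (d : Fin 4 → ℕ) → d 3F ≤ d 2F → d 2F ≤ d 1F → 3 ≤ d 3F → ∀ w → 3 ≤ w + w →
  d 0F + (w + w) ≡ ∑ (d ∘ F.suc) → w + w ≤ ∑ (d ∘ F.suc ∘ F.suc) →
  Σ (Multigraph 4) λ G → Triangular G × (∀ i → deg G i ≡ d i)
k₄-realisation d _ _ _ 1 (s≤s (s≤s ())) _ _
k₄-realisation d d₃≤d₂ d₂≤d₁ 3≤d₃ w@(suc (suc u)) _ gap few
  with w≤d₂ ← m+m≤n+n⇒m≤n
                 (≤-trans few (+-monoʳ-≤ (d 2F) (≤-trans (≤-reflexive (+-identityʳ (d 3F))) d₃≤d₂)))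
  with x , ex ← m≤n⇒∃[o]m+o≡n (≤-trans w≤d₂ d₂≤d₁)
     | y , ey ← m≤n⇒∃[o]m+o≡n w≤d₂
     | e , ee ← m≤n⇒∃[o]m+o≡n 3≤d₃
  = k₄ (suc x) (suc y) (suc e) u 1 1 , k₄-triangular x y e u 0 0 ,
    λ i → trans (deg-k₄ (suc x) (suc y) (suc e) u 1 1 i) (fits i)
  where
  fits : ∀ i → k₄-degrees (suc x) (suc y) (suc e) u 1 1 i ≡ d i
  fits 0F = +-cancelʳ-≡ (w + w) _ _ (begin
    (suc x + (suc y + suc e)) + (w + w)  ≡⟨ solve (x ∷ y ∷ e ∷ u ∷ []) ⟩
    (w + x) + ((w + y) + ((3 + e) + 0))  ≡⟨ cong₂ _+_ ex (cong₂ _+_ ey (cong (_+ 0) ee)) ⟩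
    ∑ (d ∘ F.suc)                        ≡⟨ sym gap ⟩
    d 0F + (w + w)                       ∎)
  fits 1F = begin suc x + (u + 1) ≡⟨ solve (x ∷ u ∷ []) ⟩ w + x ≡⟨ ex ⟩ d 1F ∎
  fits 2F = begin suc y + (u + 1) ≡⟨ solve (y ∷ u ∷ []) ⟩ w + y ≡⟨ ey ⟩ d 2F ∎
  fits 3F = begin suc e + (1 + 1) ≡⟨ solve (e ∷ []) ⟩ 3 + e ≡⟨ ee ⟩ d 3F ∎

lemma2p3 : (m : ℕ) → (suc m ≡ 3 ⊎ suc m ≡ 4) → (d : Fin (suc m) → ℕ) →
  (∀ i → 1 ≤ d i) →
  (∀ i j → i F.≤ j → d j ≤ d i) →
  (∀ i → 4 ≤ d i) →
  2 ∣ ∑ d →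
  d zero ≤ ∑ (λ (i : Fin m) → d (suc i) ∸ 1) →
  Σ (Multigraph (suc m)) λ G → Triangular G × (∀ i → deg G i ≡ d i)
lemma2p3 _ (inj₁ refl) d positive sorted _ even bound
  with w , gap , enough , few ← edgesAwayFromFirst d (sorted 0F 1F z≤n) even
                                  (m≤∑[d∸1]⇒m+n≤∑d (d ∘ F.suc) (positive ∘ F.suc) bound)
  = k₃-realisation d (sorted 1F 2F (s≤s z≤n)) w enough gap few
lemma2p3 _ (inj₂ refl) d positive sorted atLeast4 even bound
  with w , gap , enough , few ← edgesAwayFromFirst d (sorted 0F 1F z≤n) even
                                  (m≤∑[d∸1]⇒m+n≤∑d (d ∘ F.suc) (positive ∘ F.suc) bound)
  = k₄-realisation d (sorted 2F 3F (s≤s (s≤s z≤n))) (sorted 1F 2F (s≤s z≤n))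
      (≤-trans (n≤1+n 3) (atLeast4 3F)) w enough gap few
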